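{- Let $a,b$ be positive integers, let $x=?\left(\frac{a}{b}\right)$ and $n=\left\lfloor\frac{a}{b}\right\rfloor$. Then $?\left(\frac{a+b}{b}\right)=1+x$ and $?\left(\frac{a}{a+b}\right)=1+\frac{x}{2^{n+1}}-\frac{n+2}{2^{n+1}}$. (That is, applying $?$ to the vertex $\frac ab$ of the Calkin–Wilf tree and to its left child $\frac{a}{a+b}$ and right child $\frac{a+b}{b}$ gives $x$, $1+\frac{x}{2^{n+1}}-\frac{n+2}{2^{n+1}}$ and $1+x$ respectively.)
   Context: The Minkowski question-mark function is defined on rationals as follows: if $y=[a_0;a_1,\ldots,a_m]$ is a finite simple continued fraction of $y$ (i.e. $y=a_0+\cfrac{1}{a_1+\cfrac{1}{\ddots+\cfrac{1}{a_m}}}$ with $a_0\in\mathbb{Z}$ and $a_1,\ldots,a_m$ positive integers), then $?(y)=a_0+2\sum_{k=1}^{m}\frac{(-1)^{k+1}}{2^{a_1+a_2+\cdots+a_k}}$ (this does not depend on the choice of continued fraction). $\lfloor\cdot\rfloor$ denotes the greatest integer function. -}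

module Defs where

open import Data.Nat as ℕ using (ℕ; zero; suc; _/_; _%_)
open import Data.Integer as ℤ using (ℤ; +_)
open import Data.List using (List; []; _∷_)
open import Data.Rational using (ℚ; _+_; _-_; _*_; 0ℚ; 1ℚ; ½; floor; ↥_; ↧_; ↧ₙ_)
import Data.Rational as Q

-- The rational number a/b for natural a and positive b
-- (the value for b = 0 is an irrelevant default 0).
frac : ℕ → ℕ → ℚ
frac a zero    = 0ℚ
frac a (suc b) = (+ a) Q./ suc b

-- Partial quotients [a₁; …, aₘ] of p/q (q > 0) by the Euclidean
-- algorithm; the fuel argument bounds the number of steps
-- (fuel ≥ q + 1 always suffices, since the second argument strictly decreases).
cfNat : ℕ → ℕ → ℕ → List ℕ
cfNat zero     p q       = []
cfNat (suc f)  p zero    = []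
cfNat (suc f)  p (suc q) = (p / suc q) ∷ cfNat f (suc q) (p % suc q)

half^ : ℕ → ℚ
half^ zero    = 1ℚ
half^ (suc s) = ½ * half^ s

-- alternating tail sum:  Σ_{k=1}^{m} (-1)^{k+1} / 2^{s + a₁ + … + a_k}
altSum : ℕ → List ℕ → ℚ
altSum s []       = 0ℚ
altSum s (a ∷ as) = half^ (s ℕ.+ a) - altSum (s ℕ.+ a) as

-- Continued fraction of y = [a₀; a₁, …, aₘ]:
-- a₀ = ⌊y⌋, and [a₁; …, aₘ] is the expansion of d / r where
-- y = (a₀ d + r)/d in lowest terms, 0 ≤ r < d.
cfHead : ℚ → ℤ
cfHead y = floor y

cfTail : ℚ → List ℕ
cfTail y = cfNat (suc (↧ₙ y)) (↧ₙ y) ℤ.∣ (↥ y) ℤ.- floor y ℤ.* (↧ y) ∣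

questionMark : ℚ → ℚ
questionMark y = (cfHead y Q./ 1) + (+ 2 Q./ 1) * altSum 0 (cfTail y)

-- We first show that ?(a/b) can be read off the Euclidean algorithm run
-- directly on a and b, without reducing to lowest terms (qm-frac): the
-- algorithm is insensitive to a common factor and to surplus fuel. The
-- children of a/b then have expansions that are explicit edits of that of a/b:
--   (a+b)/b = [n+1; a₁, …]   where a/b = [n; a₁, …],            so ? grows by 1;
--   a/(a+b) = [0; k+1, …]    where a/b = [0; k, …]    (a < b),
--   a/(a+b) = [0; 2]                                  (a = b),
--   a/(a+b) = [0; 1, n, a₁, …] where a/b = [n; a₁, …] (b < a).
-- The alternating sums defining ? transform under these edits by shifting the
-- exponents (altSum-shift), and in each case a ring identity over ℚ finishes.
module Submission where

open import Defs
open import Data.Nat using (ℕ; _^_; NonZero)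
open import Data.Nat as ℕ using ()
open import Data.Product using (_×_)
open import Relation.Binary.PropositionalEquality using (_≡_)
open import Data.Rational using (ℚ; _+_; _-_; _*_; 1ℚ)

open import Data.Nat using (zero; suc; _<_; s≤s)
import Data.Nat.Properties as ℕP
import Data.Nat.DivMod as ℕD
open import Data.Nat.Divisibility using (∣-refl)
import Data.Nat.GCD as G
open import Data.Integer as ℤ using (+_)
import Data.Integer.Properties as ℤP
open import Data.List using ([]; _∷_)
open import Data.Rational as Q using (0ℚ; mkℚ; ½; ↥_; ↧ₙ_; normalize)
import Data.Rational.Properties as QP
import Data.Rational.Unnormalised as U
import Data.Rational.Unnormalised.Properties as UP
open import Data.Rational.Solver using (module +-*-Solver)
open import Data.Product using (_,_)
open import Data.Sum using (inj₂)
open import Relation.Binary using (tri<; tri≈; tri>)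
open import Relation.Binary.PropositionalEquality using (refl; sym; trans; cong; cong₂; module ≡-Reasoning)

cfNat-step : ∀ f p q .{{_ : NonZero q}} →
  cfNat (suc f) p q ≡ (p ℕ./ q) ∷ cfNat f q (p ℕ.% q)
cfNat-step f p (suc q) = refl

-- Once the fuel exceeds the denominator the algorithm runs to completion,
-- so any two sufficient fuels give the same expansion.
cfNat-fuel : ∀ f f′ p q → q < f → q < f′ → cfNat f p q ≡ cfNat f′ p q
cfNat-fuel (suc f) (suc f′) p zero    _       _        = refl
cfNat-fuel (suc f) (suc f′) p (suc q) (s≤s q≤f) (s≤s q≤f′) =
  cong ((p ℕ./ suc q) ∷_) (cfNat-fuel f f′ (suc q) r (ℕP.<-≤-trans r<q q≤f) (ℕP.<-≤-trans r<q q≤f′))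
  where
  r = p ℕ.% suc q
  r<q = ℕD.m%n<n p (suc q)

-- The expansion of p/q depends only on the ratio: scaling numerator and
-- denominator by k scales every remainder by k and fixes every quotient.
cfNat-scale : ∀ f p q k .{{_ : NonZero k}} → cfNat f (p ℕ.* k) (q ℕ.* k) ≡ cfNat f p q
cfNat-scale zero    p q       k = refl
cfNat-scale (suc f) p zero    k = refl
cfNat-scale (suc f) p (suc q) k = begin
    cfNat (suc f) (p ℕ.* k) (suc q ℕ.* k)
  ≡⟨ cfNat-step f (p ℕ.* k) (suc q ℕ.* k) ⟩
    (p ℕ.* k) ℕ./ (suc q ℕ.* k) ∷ cfNat f (suc q ℕ.* k) ((p ℕ.* k) ℕ.% (suc q ℕ.* k))
  ≡⟨ cong₂ (λ n r → n ∷ cfNat f (suc q ℕ.* k) r)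
       (ℕD.m*n/o*n≡m/o p k (suc q)) (sym (ℕD.m%n*o≡m*o%[n*o] p (suc q) k)) ⟩
    p ℕ./ suc q ∷ cfNat f (suc q ℕ.* k) ((p ℕ.% suc q) ℕ.* k)
  ≡⟨ cong (p ℕ./ suc q ∷_) (cfNat-scale f (suc q) (p ℕ.% suc q) k) ⟩
    p ℕ./ suc q ∷ cfNat f (suc q) (p ℕ.% suc q)
  ∎
  where
  open ≡-Reasoning
  instance _ = ℕP.m*n≢0 (suc q) k

qmℕ : (p d f : ℕ) .{{_ : NonZero d}} → ℚ
qmℕ p d f = frac (p ℕ./ d) 1 + frac 2 1 * altSum 0 (cfNat f d (p ℕ.% d))

qmℕ-fuel : ∀ p d f f′ .{{_ : NonZero d}} → d < f → d < f′ → qmℕ p d f ≡ qmℕ p d f′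
qmℕ-fuel p d f f′ d<f d<f′ =
  cong (λ L → frac (p ℕ./ d) 1 + frac 2 1 * altSum 0 L)
    (cfNat-fuel f f′ d (p ℕ.% d) (ℕP.<-trans (ℕD.m%n<n p d) d<f) (ℕP.<-trans (ℕD.m%n<n p d) d<f′))

qmℕ-scale : ∀ p d k f .{{_ : NonZero d}} .{{_ : NonZero k}} .{{_ : NonZero (d ℕ.* k)}} →
  qmℕ (p ℕ.* k) (d ℕ.* k) f ≡ qmℕ p d f
qmℕ-scale p d k f = cong₂ (λ n L → frac n 1 + frac 2 1 * altSum 0 L)
  (ℕD.m*n/o*n≡m/o p k d)
  (trans (cong (cfNat f (d ℕ.* k)) (sym (ℕD.m%n*o≡m*o%[n*o] p d k))) (cfNat-scale f d (p ℕ.% d) k))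

-- For a non-negative rational in lowest terms p/d, the definition of ? unfolds
-- to qmℕ: the floor is p div d and the remainder p - ⌊p/d⌋·d is p mod d.
qm-lowest-terms : ∀ y p d .{{_ : NonZero d}} → ↥ y ≡ + p → ↧ₙ y ≡ d →
  questionMark y ≡ qmℕ p d (suc d)
qm-lowest-terms (mkℚ (+ p) d-1 _) p (suc d-1) refl refl =
  cong₂ (λ n r → n Q./ 1 + frac 2 1 * altSum 0 (cfNat (suc d) d r)) floor≡ remainder≡
  where
  d = suc d-1
  floor≡ : + p ℤ./ + d ≡ + (p ℕ./ d)
  floor≡ = ℤP.*-identityˡ _
  remainder≡ : ℤ.∣ + p ℤ.- (+ p ℤ./ + d) ℤ.* + d ∣ ≡ p ℕ.% d
  remainder≡ rewrite floor≡ | sym (ℤP.pos-* (p ℕ./ d) d) | ℤP.m-n≡m⊖n p (p ℕ./ d ℕ.* d)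
    | ℤP.⊖-≥ (ℕD.m/n*n≤m p d) = sym (ℕD.m%n≡m∸m/n*n p d)

-- ? of a fraction a/b (not necessarily in lowest terms) is qmℕ a b f for
-- every fuel f > b: reduce to lowest terms a/g, b/g (g = gcd a b), read ?
-- off there, and scale back by g.
qm-frac : ∀ a b f .{{_ : NonZero b}} → b < f → questionMark (frac a b) ≡ qmℕ a b f
qm-frac a b@(suc _) f b<f = begin
    questionMark (normalize a b)
  ≡⟨ qm-lowest-terms (normalize a b) p d (QP.↥-mkℚ+ p d) (cong ℤ.∣_∣ (QP.↧-mkℚ+ p d)) ⟩
    qmℕ p d (suc d)
  ≡⟨ qmℕ-fuel p d (suc d) f (ℕP.n<1+n d) (ℕP.≤-<-trans (ℕD.m/n≤m b g) b<f) ⟩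
    qmℕ p d f
  ≡⟨ sym (qmℕ-scale p d g f) ⟩
    qmℕ (p ℕ.* g) (d ℕ.* g) f
  ≡⟨ unscale (ℕD.m/n*n≡m (G.gcd[m,n]∣m a b)) (ℕD.m/n*n≡m (G.gcd[m,n]∣n a b)) ⟩
    qmℕ a b f
  ∎
  where
  open ≡-Reasoning
  g = G.gcd a b
  instance g≢0 = ℕ.≢-nonZero (G.gcd[m,n]≢0 a b (inj₂ λ ()))
  instance d≢0 = ℕ.≢-nonZero (G.n/gcd[m,n]≢0 a b {{gcd≢0 = g≢0}})
  instance dg≢0 = ℕP.m*n≢0 (b ℕ./ g) g
  p = a ℕ./ g
  d = b ℕ./ g
  unscale : ∀ {a′ b′} .{{_ : NonZero b′}} → a′ ≡ a → b′ ≡ b → qmℕ a′ b′ f ≡ qmℕ a b f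
  unscale refl refl = refl

half^-+ : ∀ k s → half^ (k ℕ.+ s) ≡ half^ k * half^ s
half^-+ zero    s = sym (QP.*-identityˡ (half^ s))
half^-+ (suc k) s = trans (cong (½ *_) (half^-+ k s)) (sym (QP.*-assoc ½ (half^ k) (half^ s)))

altSum-shift : ∀ k s L → altSum (k ℕ.+ s) L ≡ half^ k * altSum s L
altSum-shift k s []       = sym (QP.*-zeroʳ (half^ k))
altSum-shift k s (a ∷ as) = begin
    half^ (k ℕ.+ s ℕ.+ a) - altSum (k ℕ.+ s ℕ.+ a) as
  ≡⟨ cong (λ e → half^ e - altSum e as) (ℕP.+-assoc k s a) ⟩
    half^ (k ℕ.+ (s ℕ.+ a)) - altSum (k ℕ.+ (s ℕ.+ a)) as
  ≡⟨ cong₂ _-_ (half^-+ k (s ℕ.+ a)) (altSum-shift k (s ℕ.+ a) as) ⟩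
    half^ k * half^ (s ℕ.+ a) - half^ k * altSum (s ℕ.+ a) as
  ≡⟨ solve 3 (λ h x y → h :* x :- h :* y := h :* (x :- y)) refl
       (half^ k) (half^ (s ℕ.+ a)) (altSum (s ℕ.+ a) as) ⟩
    half^ k * (half^ (s ℕ.+ a) - altSum (s ℕ.+ a) as)
  ∎
  where
  open ≡-Reasoning
  open +-*-Solver

fromℚᵘ-homo-* : ∀ p q → Q.fromℚᵘ p * Q.fromℚᵘ q ≡ Q.fromℚᵘ (p U.* q)
fromℚᵘ-homo-* p q = trans (sym (QP.fromℚᵘ-toℚᵘ _)) (QP.fromℚᵘ-cong (UP.≃-trans
  (QP.toℚᵘ-homo-* (Q.fromℚᵘ p) (Q.fromℚᵘ q)) (UP.*-cong (QP.toℚᵘ-fromℚᵘ p) (QP.toℚᵘ-fromℚᵘ q))))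

fromℚᵘ-homo-+ : ∀ p q → Q.fromℚᵘ p + Q.fromℚᵘ q ≡ Q.fromℚᵘ (p U.+ q)
fromℚᵘ-homo-+ p q = trans (sym (QP.fromℚᵘ-toℚᵘ _)) (QP.fromℚᵘ-cong (UP.≃-trans
  (QP.toℚᵘ-homo-+ (Q.fromℚᵘ p) (Q.fromℚᵘ q)) (UP.+-cong (QP.toℚᵘ-fromℚᵘ p) (QP.toℚᵘ-fromℚᵘ q))))

frac-* : ∀ m p n q .{{_ : NonZero p}} .{{_ : NonZero q}} →
  frac m p * frac n q ≡ frac (m ℕ.* n) (p ℕ.* q)
frac-* m (suc p) n (suc q) = trans (fromℚᵘ-homo-* (U.mkℚᵘ (+ m) p) (U.mkℚᵘ (+ n) q))
  (cong (Q._/ (suc p ℕ.* suc q)) (sym (ℤP.pos-* m n)))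

frac-+ : ∀ m n → frac m 1 + frac n 1 ≡ frac (m ℕ.+ n) 1
frac-+ m n = trans (fromℚᵘ-homo-+ (U.mkℚᵘ (+ m) 0) (U.mkℚᵘ (+ n) 0))
  (cong (Q._/ 1) (trans (cong₂ ℤ._+_ (ℤP.*-identityʳ (+ m)) (ℤP.*-identityʳ (+ n))) (sym (ℤP.pos-+ m n))))

half^≡frac : ∀ k → half^ k ≡ frac 1 (2 ^ k)
half^≡frac zero    = refl
half^≡frac (suc k) = trans (cong (½ *_) (half^≡frac k)) (frac-* 1 2 1 (2 ^ k))
  where instance _ = ℕP.m^n≢0 2 k

frac-2^ : ∀ m k → frac m (2 ^ k) ≡ frac m 1 * half^ k
frac-2^ m k = begin
    frac m (2 ^ k)
  ≡⟨ cong₂ frac (sym (ℕP.*-identityʳ m)) (sym (ℕP.*-identityˡ (2 ^ k))) ⟩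
    frac (m ℕ.* 1) (1 ℕ.* 2 ^ k)
  ≡⟨ sym (frac-* m 1 1 (2 ^ k)) ⟩
    frac m 1 * frac 1 (2 ^ k)
  ≡⟨ cong (frac m 1 *_) (sym (half^≡frac k)) ⟩
    frac m 1 * half^ k
  ∎
  where
  open ≡-Reasoning
  instance _ = ℕP.m^n≢0 2 k

-- Adding d to the numerator raises the integer part by one and leaves the
-- expansion of the fractional part unchanged.
qmℕ-+d : ∀ p d f .{{_ : NonZero d}} → qmℕ (p ℕ.+ d) d f ≡ 1ℚ + qmℕ p d f
qmℕ-+d p d f = begin
    frac ((p ℕ.+ d) ℕ./ d) 1 + Two * T′
  ≡⟨ cong₂ (λ n r → frac n 1 + Two * altSum 0 (cfNat f d r)) quotient≡ (ℕD.[m+n]%n≡m%n p d) ⟩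
    frac (p ℕ./ d ℕ.+ 1) 1 + Two * T
  ≡⟨ cong (_+ Two * T) (sym (frac-+ (p ℕ./ d) 1)) ⟩
    (frac (p ℕ./ d) 1 + 1ℚ) + Two * T
  ≡⟨ solve 2 (λ N T → (N :+ con 1ℚ) :+ con Two :* T := con 1ℚ :+ (N :+ con Two :* T)) refl
       (frac (p ℕ./ d) 1) T ⟩
    1ℚ + (frac (p ℕ./ d) 1 + Two * T)
  ∎
  where
  open ≡-Reasoning
  open +-*-Solver
  Two = frac 2 1
  T′ = altSum 0 (cfNat f d ((p ℕ.+ d) ℕ.% d))
  T = altSum 0 (cfNat f d (p ℕ.% d))
  quotient≡ : (p ℕ.+ d) ℕ./ d ≡ p ℕ./ d ℕ.+ 1
  quotient≡ = trans (ℕD.+-distrib-/-∣ʳ p ∣-refl) (cong (p ℕ./ d ℕ.+_) (ℕD.n/n≡1 d))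

right-child : ∀ a b .{{_ : NonZero b}} → questionMark (frac (a ℕ.+ b) b) ≡ 1ℚ + questionMark (frac a b)
right-child a b = begin
    questionMark (frac (a ℕ.+ b) b)  ≡⟨ qm-frac (a ℕ.+ b) b f b<f ⟩
    qmℕ (a ℕ.+ b) b f                ≡⟨ qmℕ-+d a b f ⟩
    1ℚ + qmℕ a b f                   ≡⟨ cong (λ z → 1ℚ + z) (sym (qm-frac a b f b<f)) ⟩
    1ℚ + questionMark (frac a b)     ∎
  where
  open ≡-Reasoning
  f = suc (a ℕ.+ b)
  b<f = s≤s (ℕP.m≤n+m b a)

qm-below-one : ∀ p q f .{{_ : NonZero p}} .{{_ : NonZero q}} → p < q → q < f →
  questionMark (frac p q) ≡ frac 2 1 * altSum 0 ((q ℕ./ p) ∷ cfNat f p (q ℕ.% p))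
qm-below-one p q f p<q q<f = begin
    questionMark (frac p q)
  ≡⟨ qm-frac p q (suc f) (ℕP.<-trans q<f (ℕP.n<1+n f)) ⟩
    frac (p ℕ./ q) 1 + frac 2 1 * altSum 0 (cfNat (suc f) q (p ℕ.% q))
  ≡⟨ cong₂ (λ n r → frac n 1 + frac 2 1 * altSum 0 (cfNat (suc f) q r))
       (ℕD.m<n⇒m/n≡0 p<q) (ℕD.m<n⇒m%n≡m p<q) ⟩
    0ℚ + frac 2 1 * altSum 0 (cfNat (suc f) q p)
  ≡⟨ QP.+-identityˡ _ ⟩
    frac 2 1 * altSum 0 (cfNat (suc f) q p)
  ≡⟨ cong (λ L → frac 2 1 * altSum 0 L) (cfNat-step f q p) ⟩
    frac 2 1 * altSum 0 ((q ℕ./ p) ∷ cfNat f p (q ℕ.% p))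
  ∎
  where open ≡-Reasoning

qm-left-child : ∀ a b f .{{_ : NonZero a}} .{{_ : NonZero b}} → a ℕ.+ b < f →
  questionMark (frac a (a ℕ.+ b)) ≡ frac 2 1 * altSum 0 (suc (b ℕ./ a) ∷ cfNat f a (b ℕ.% a))
qm-left-child a@(suc _) b@(suc _) f a+b<f = begin
    questionMark (frac a (a ℕ.+ b))
  ≡⟨ qm-below-one a (a ℕ.+ b) f (ℕP.m<m+n a ℕ.z<s) a+b<f ⟩
    frac 2 1 * altSum 0 (((a ℕ.+ b) ℕ./ a) ∷ cfNat f a ((a ℕ.+ b) ℕ.% a))
  ≡⟨ cong₂ (λ k r → frac 2 1 * altSum 0 (k ∷ cfNat f a r)) quotient≡ (ℕD.%-remove-+ˡ b ∣-refl) ⟩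
    frac 2 1 * altSum 0 (suc (b ℕ./ a) ∷ cfNat f a (b ℕ.% a))
  ∎
  where
  open ≡-Reasoning
  quotient≡ : (a ℕ.+ b) ℕ./ a ≡ suc (b ℕ./ a)
  quotient≡ = trans (ℕD.+-distrib-/-∣ˡ b ∣-refl) (cong (ℕ._+ b ℕ./ a) (ℕD.n/n≡1 a))

altSum-suc-head : ∀ k L → altSum 0 (suc k ∷ L) ≡ ½ * altSum 0 (k ∷ L)
altSum-suc-head k L = begin
    ½ * half^ k - altSum (1 ℕ.+ k) L
  ≡⟨ cong (½ * half^ k -_) (altSum-shift 1 k L) ⟩
    ½ * half^ k - (½ * 1ℚ) * altSum k L
  ≡⟨ solve 2 (λ h S → con ½ :* h :- (con ½ :* con 1ℚ) :* S := con ½ :* (h :- S)) refl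
       (half^ k) (altSum k L) ⟩
    ½ * (half^ k - altSum k L)
  ∎
  where
  open ≡-Reasoning
  open +-*-Solver

leftChildValue : ℚ → ℕ → ℚ
leftChildValue x n = (1ℚ + x * frac 1 (2 ^ (n ℕ.+ 1))) - frac (n ℕ.+ 2) (2 ^ (n ℕ.+ 1))

leftChildValue-half : ∀ x n →
  leftChildValue x n ≡ (1ℚ + x * half^ (suc n)) - (frac n 1 + frac 2 1) * half^ (suc n)
leftChildValue-half x n = begin
    (1ℚ + x * frac 1 (2 ^ (n ℕ.+ 1))) - frac (n ℕ.+ 2) (2 ^ (n ℕ.+ 1))
  ≡⟨ cong₂ (λ u v → (1ℚ + x * u) - v) (frac-2^ 1 (n ℕ.+ 1)) (frac-2^ (n ℕ.+ 2) (n ℕ.+ 1)) ⟩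
    (1ℚ + x * (1ℚ * half^ (n ℕ.+ 1))) - frac (n ℕ.+ 2) 1 * half^ (n ℕ.+ 1)
  ≡⟨ cong₂ (λ u v → (1ℚ + x * u) - v) (QP.*-identityˡ _) (cong (_* half^ (n ℕ.+ 1)) (sym (frac-+ n 2))) ⟩
    (1ℚ + x * half^ (n ℕ.+ 1)) - (frac n 1 + frac 2 1) * half^ (n ℕ.+ 1)
  ≡⟨ cong (λ e → (1ℚ + x * half^ e) - (frac n 1 + frac 2 1) * half^ e) (ℕP.+-comm n 1) ⟩
    (1ℚ + x * half^ (suc n)) - (frac n 1 + frac 2 1) * half^ (suc n)
  ∎
  where open ≡-Reasoning

-- Left child when a < b: a/(a+b) differs from a/b = [0; k, …] only in the
-- first partial quotient k+1, so ?(a/(a+b)) = ?(a/b)/2, the formula for n = 0.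
left-child-< : ∀ a b .{{_ : NonZero a}} .{{_ : NonZero b}} → a < b →
  questionMark (frac a (a ℕ.+ b)) ≡ leftChildValue (questionMark (frac a b)) (a ℕ./ b)
left-child-< a b a<b = begin
    questionMark (frac a (a ℕ.+ b))
  ≡⟨ qm-left-child a b f (ℕP.n<1+n _) ⟩
    Two * altSum 0 (suc k ∷ M)
  ≡⟨ cong (Two *_) (altSum-suc-head k M) ⟩
    Two * (½ * A)
  ≡⟨ solve 1 (λ A → con Two :* (con ½ :* A)
                := (con 1ℚ :+ (con Two :* A) :* con (half^ 1)) :- (con (frac 0 1) :+ con Two) :* con (half^ 1))
       refl A ⟩
    (1ℚ + (Two * A) * half^ 1) - (frac 0 1 + Two) * half^ 1
  ≡⟨ sym (leftChildValue-half (Two * A) 0) ⟩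
    leftChildValue (Two * A) 0
  ≡⟨ cong₂ leftChildValue (sym (qm-below-one a b f a<b (s≤s (ℕP.m≤n+m b a)))) (sym (ℕD.m<n⇒m/n≡0 a<b)) ⟩
    leftChildValue (questionMark (frac a b)) (a ℕ./ b)
  ∎
  where
  open ≡-Reasoning
  open +-*-Solver
  Two = frac 2 1
  f = suc (a ℕ.+ b)
  k = b ℕ./ a
  M = cfNat f a (b ℕ.% a)
  A = altSum 0 (k ∷ M)

-- Left child when a = b: ?(1/2) = 1/2 and ?(1) = 1, checked by computation.
left-child-≡ : ∀ a .{{_ : NonZero a}} →
  questionMark (frac a (a ℕ.+ a)) ≡ leftChildValue (questionMark (frac a a)) (a ℕ./ a)
left-child-≡ a = begin
    questionMark (frac a (a ℕ.+ a))
  ≡⟨ qm-left-child a a f (ℕP.n<1+n _) ⟩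
    frac 2 1 * altSum 0 (suc (a ℕ./ a) ∷ cfNat f a (a ℕ.% a))
  ≡⟨ cong₂ (λ k r → frac 2 1 * altSum 0 (suc k ∷ cfNat f a r)) (ℕD.n/n≡1 a) (ℕD.n%n≡0 a) ⟩
    frac 2 1 * altSum 0 (2 ∷ [])
  ≡⟨ refl ⟩
    leftChildValue (frac 1 1 + frac 2 1 * altSum 0 []) 1
  ≡⟨ cong₂ leftChildValue (sym qm-one) (sym (ℕD.n/n≡1 a)) ⟩
    leftChildValue (questionMark (frac a a)) (a ℕ./ a)
  ∎
  where
  open ≡-Reasoning
  f = suc (a ℕ.+ a)
  qm-one : questionMark (frac a a) ≡ frac 1 1 + frac 2 1 * altSum 0 []
  qm-one = trans (qm-frac a a f (s≤s (ℕP.m≤n+m a a)))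
    (cong₂ (λ n r → frac n 1 + frac 2 1 * altSum 0 (cfNat f a r)) (ℕD.n/n≡1 a) (ℕD.n%n≡0 a))

-- Left child when b < a: a/(a+b) = [0; 1, n, …] where a/b = [n; …], so with
-- T the tail sum of a/b and h = ½^{n+1}, ?(a/(a+b)) = 1 - 2h + 2hT.
left-child-> : ∀ a b .{{_ : NonZero a}} .{{_ : NonZero b}} → b < a →
  questionMark (frac a (a ℕ.+ b)) ≡ leftChildValue (questionMark (frac a b)) (a ℕ./ b)
left-child-> a b b<a = begin
    questionMark (frac a (a ℕ.+ b))
  ≡⟨ qm-left-child a b (suc f) (ℕP.m<n⇒m<1+n (ℕP.n<1+n _)) ⟩
    Two * altSum 0 (suc (b ℕ./ a) ∷ cfNat (suc f) a (b ℕ.% a))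
  ≡⟨ cong₂ (λ k r → Two * altSum 0 (suc k ∷ cfNat (suc f) a r)) (ℕD.m<n⇒m/n≡0 b<a) (ℕD.m<n⇒m%n≡m b<a) ⟩
    Two * altSum 0 (1 ∷ cfNat (suc f) a b)
  ≡⟨ cong (λ L → Two * altSum 0 (1 ∷ L)) (cfNat-step f a b) ⟩
    Two * (½ * 1ℚ - (h - altSum (suc n) L))
  ≡⟨ cong (λ S → Two * (½ * 1ℚ - (h - S))) tail≡ ⟩
    Two * (½ * 1ℚ - (h - h * T))
  ≡⟨ solve 3 (λ h T N → con Two :* (con ½ :* con 1ℚ :- (h :- h :* T))
                      := (con 1ℚ :+ (N :+ con Two :* T) :* h) :- (N :+ con Two) :* h)
       refl h T (frac n 1) ⟩
    (1ℚ + (frac n 1 + Two * T) * h) - (frac n 1 + Two) * h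
  ≡⟨ sym (leftChildValue-half (frac n 1 + Two * T) n) ⟩
    leftChildValue (qmℕ a b f) n
  ≡⟨ cong (λ x → leftChildValue x n) (sym (qm-frac a b f (s≤s (ℕP.m≤n+m b a)))) ⟩
    leftChildValue (questionMark (frac a b)) n
  ∎
  where
  open ≡-Reasoning
  open +-*-Solver
  Two = frac 2 1
  f = suc (a ℕ.+ b)
  n = a ℕ./ b
  L = cfNat f b (a ℕ.% b)
  T = altSum 0 L
  h = half^ (suc n)
  tail≡ : altSum (suc n) L ≡ h * T
  tail≡ = trans (cong (λ s → altSum s L) (sym (ℕP.+-identityʳ (suc n)))) (altSum-shift (suc n) 0 L)

left-child : ∀ a b .{{_ : NonZero a}} .{{_ : NonZero b}} →
  questionMark (frac a (a ℕ.+ b)) ≡ leftChildValue (questionMark (frac a b)) (a ℕ./ b)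
left-child a b with ℕP.<-cmp a b
... | tri< a<b _ _ = left-child-< a b a<b
... | tri≈ _ refl _ = left-child-≡ a
... | tri> _ _ b<a = left-child-> a b b<a

mainTheorem5 : (a b : ℕ) .{{_ : NonZero a}} .{{_ : NonZero b}} →
    let x = questionMark (frac a b)
        n = a ℕ./ b
    in questionMark (frac (a ℕ.+ b) b) ≡ 1ℚ + x
     × questionMark (frac a (a ℕ.+ b))
         ≡ (1ℚ + x * frac 1 (2 ^ (n ℕ.+ 1))) - frac (n ℕ.+ 2) (2 ^ (n ℕ.+ 1))
mainTheorem5 a b = right-child a b , left-child a b
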